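{- Assume the $abc$-conjecture: for every $\epsilon>0$ there is a constant $\kappa(\epsilon)>0$ such that whenever $a,b,c$ are coprime positive integers with $a+b=c$, one has $c<\kappa(\epsilon)\,\mathrm{Rad}(abc)^{1+\epsilon}$. Then for every integer $m\ge 4$, $$\frac{3m-6}{4m-6}\le \theta_m\le \frac{2m-4}{2m-3}.$$
   Context: A positive integer is squarefull if every prime dividing it divides it at least to the second power. $\mathrm{Rad}(n)$ is the product of the distinct primes dividing $n$. For $m\ge 3$, $$\theta_m=\liminf\left\{\frac{\log d}{\log N}\ :\ N,d\in\mathbb{N},\ N,N+d,\ldots,N+(m-1)d\ \text{all squarefull}\right\},$$ the liminf being taken as $N\to\infty$ over such pairs $(N,d)$. -}

module Defs where

open import Data.Nat using (ℕ; suc; _+_; _*_; _∸_; _^_; _≤_; _<_)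
open import Relation.Binary.PropositionalEquality using (_≡_)
open import Data.Nat.Divisibility using (_∣_; _∣?_)
open import Data.Nat.Primality using (Prime; prime?)
open import Data.Nat.Coprimality using (Coprime)
open import Data.List using (List; filter; upTo)
open import Data.Nat.ListAction using (product)
open import Data.Product using (_×_; ∃; Σ-syntax; ∃-syntax)
open import Data.Fin using (Fin; toℕ)
open import Relation.Nullary.Decidable using (_×-dec_)

Squarefull : ℕ → Set
Squarefull n = ∀ p → Prime p → p ∣ n → p ^ 2 ∣ n

Rad : ℕ → ℕ
Rad n = product (filter (λ p → prime? p ×-dec (p ∣? n)) (upTo (suc n)))

SquarefullAP : ℕ → ℕ → ℕ → Set
SquarefullAP m N d = (i : Fin m) → Squarefull (N + toℕ i * d)

-- The abc-conjecture.  c < κ(ε) Rad(abc)^(1+ε) with ε = 1/k and κ^k ≤ K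
-- is encoded as  c^k < K * Rad(abc)^(k+1)  (raise to the k-th power).
ABC : Set
ABC = ∀ k → 1 ≤ k → ∃[ K ] (∀ a b c → 1 ≤ a → 1 ≤ b → Coprime a b → a + b ≡ c →
        c ^ k < K * Rad (a * b * c) ^ (k + 1))

-- θ_m ≥ (3m-6)/(4m-6): for every ε = 1/k there is N₀ such that all squarefull
-- APs (N,d) with d ≥ 1, N ≥ N₀ satisfy log d ≥ ((3m-6)/(4m-6) - 1/k) log N,
-- i.e. d^((4m-6)k) * N^(4m-6) ≥ N^((3m-6)k).
ThetaLower : ℕ → Set
ThetaLower m = ∀ k → 1 ≤ k → ∃[ N₀ ] (∀ N d → N₀ ≤ N → 1 ≤ d → SquarefullAP m N d →
        N ^ ((3 * m ∸ 6) * k) ≤ d ^ ((4 * m ∸ 6) * k) * N ^ (4 * m ∸ 6))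

-- θ_m ≤ (2m-4)/(2m-3): for every ε = 1/k and every N₀ there is a squarefull AP
-- (N,d) with d ≥ 1, N ≥ N₀ and log d ≤ ((2m-4)/(2m-3) + 1/k) log N,
-- i.e. d^((2m-3)k) ≤ N^((2m-4)k + (2m-3)).
ThetaUpper : ℕ → Set
ThetaUpper m = ∀ k → 1 ≤ k → ∀ N₀ → ∃[ N ] ∃[ d ] (N₀ ≤ N × 1 ≤ d × SquarefullAP m N d ×
        d ^ ((2 * m ∸ 3) * k) ≤ N ^ ((2 * m ∸ 4) * k + (2 * m ∸ 3)))

{-# OPTIONS --safe #-}
-- Put h = gcd N d, N = n h and d = e h; then each z_i = n + i e is coprime to e and to its
-- neighbours, and each z_i h is squarefull. For four terms z₀z₂³ + e³(2n + 3e) = z₁³z₃, for five terms a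
-- degree 16 identity A + B = C holds among the z_i; in both gcd A B is bounded and every prime of ABC
-- divides some z_i, e or the cofactor R of B, so Rad(ABC)² divides M = (∏ z_i) h (e R)² = O(h e² n^β).
-- As C ≥ n^α, the abc conjecture (squared) gives n^(2α - β - ε) ≪ h e², hence N² ≪ d^(3 + ε) from four
-- terms and N³ ≪ d^(4 + ε) from five: θ₄ ≥ 2/3 and θ_m ≥ 3/4 for m ≥ 5, both at least (3m - 6)/(4m - 6).
--
-- Upper bound. If a and a + 1 are squarefull and Q = (a + 2)(a + 3)⋯(a + m - 1), then Q²a, Q²(a + 1), …,
-- Q²(a + m - 1) are all squarefull, with d = Q² ≈ a^(2m - 4) and N = Q²a ≈ a^(2m - 3).
module Submission where

open import Defs
open import Data.Nat using (ℕ; _≤_)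
open import Data.Product using (_×_)

open import Data.Nat using (zero; suc; _+_; _*_; _∸_; _^_; _<_; _>_; z≤n; s≤s; NonZero; >-nonZero; >-nonZero⁻¹; ≢-nonZero; _≤?_)
open import Data.Nat.Properties
open import Data.Nat.Divisibility
open import Data.Nat.DivMod using (_/_; m*n/n≡m; /-congˡ)
open import Data.Nat.Primality using (Prime; prime?; euclidsLemma; prime⇒irreducible; ¬prime[1])
open import Data.Nat.Coprimality as Coprime using (Coprime; coprime-divisor; coprime-/gcd; 1-coprimeTo)
open import Data.Nat.GCD using (gcd; gcd[m,n]∣m; gcd[m,n]∣n; gcd[m,n]≢0)
open import Data.Nat.ListAction using (product)
open import Data.List using (List; []; _∷_; filter; upTo)
open import Data.List.Relation.Unary.All as All using (All; []; _∷_)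
open import Data.List.Relation.Unary.AllPairs using (AllPairs; []; _∷_)
open import Data.List.Relation.Unary.All.Properties using (all-filter)
import Data.List.Relation.Unary.Unique.Propositional.Properties as Unique
open import Data.Fin as Fin using (Fin; toℕ; #_)
import Data.Fin.Properties as FinP
open import Data.Product using (_,_; proj₁; proj₂; map₂; ∃-syntax)
open import Data.Sum using (inj₁; inj₂)
open import Data.Empty using (⊥-elim)
open import Relation.Nullary using (yes; no)
open import Relation.Nullary.Decidable using (_×-dec_)
open import Relation.Binary.PropositionalEquality
open import Data.Nat.Solver using (module +-*-Solver)
open +-*-Solver

-- Powers, coprimality and radicals

^-distribʳ-* : ∀ a b j → (a * b) ^ j ≡ a ^ j * b ^ j
^-distribʳ-* a b zero = refl
^-distribʳ-* a b (suc j) = begin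
  a * b * (a * b) ^ j     ≡⟨ cong (a * b *_) (^-distribʳ-* a b j) ⟩
  a * b * (a ^ j * b ^ j) ≡⟨ solve 4 (λ a b x y → a :* b :* (x :* y) := a :* x :* (b :* y)) refl a b (a ^ j) (b ^ j) ⟩
  a * a ^ j * (b * b ^ j) ∎
  where open ≡-Reasoning

^-*-comm : ∀ a i j → (a ^ i) ^ j ≡ (a ^ j) ^ i
^-*-comm a i j = trans (^-*-assoc a i j) (trans (cong (a ^_) (*-comm i j)) (sym (^-*-assoc a j i)))

^-monoˡ-∣ : ∀ {a b} j → a ∣ b → a ^ j ∣ b ^ j
^-monoˡ-∣ zero    _   = ∣-refl
^-monoˡ-∣ (suc j) a∣b = *-pres-∣ a∣b (^-monoˡ-∣ j a∣b)

^-cancelʳ-≤ : ∀ {x y} T .{{_ : NonZero T}} → x ^ T ≤ y ^ T → x ≤ y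
^-cancelʳ-≤ {x} {y} T x^T≤y^T with x ≤? y
... | yes x≤y = x≤y
... | no  x≰y = ⊥-elim (<⇒≱ (^-monoˡ-< T (≰⇒> x≰y)) x^T≤y^T)

m*n>0⇒m>0 : ∀ {m n} → m * n > 0 → m > 0
m*n>0⇒m>0 {suc m} _ = s≤s z≤n

m+n≡o⇒m≤o : ∀ {m o} n → m + n ≡ o → m ≤ o
m+n≡o⇒m≤o {m} n refl = m≤m+n m n

prime∣^⇒prime∣ : ∀ {p a} j → Prime p → p ∣ a ^ j → p ∣ a
prime∣^⇒prime∣ zero p-prime p∣1 = ⊥-elim (¬prime[1] (subst Prime (∣1⇒≡1 p∣1) p-prime))
prime∣^⇒prime∣ {a = a} (suc j) p-prime p∣a^j+1 with euclidsLemma a (a ^ j) p-prime p∣a^j+1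
... | inj₁ p∣a   = p∣a
... | inj₂ p∣a^j = prime∣^⇒prime∣ j p-prime p∣a^j

coprime-∣ˡ : ∀ {a b d} → Coprime a b → d ∣ a → Coprime d b
coprime-∣ˡ a⊥b d∣a (x∣d , x∣b) = a⊥b (∣-trans x∣d d∣a , x∣b)

coprime-*ʳ : ∀ {a b c} → Coprime a b → Coprime a c → Coprime a (b * c)
coprime-*ʳ a⊥b a⊥c (x∣a , x∣bc) = a⊥c (x∣a , coprime-divisor (coprime-∣ˡ a⊥b x∣a) x∣bc)

coprime-^ʳ : ∀ {a b} j → Coprime a b → Coprime a (b ^ j)
coprime-^ʳ {a} zero    _   = Coprime.sym (1-coprimeTo a)
coprime-^ʳ     (suc j) a⊥b = coprime-*ʳ a⊥b (coprime-^ʳ j a⊥b)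

coprime-^ : ∀ {a b} i j → Coprime a b → Coprime (a ^ i) (b ^ j)
coprime-^ i j a⊥b = Coprime.sym (coprime-^ʳ i (Coprime.sym (coprime-^ʳ j a⊥b)))

coprime⇒*∣ : ∀ {a b M} → Coprime a b → a ∣ M → b ∣ M → a * b ∣ M
coprime⇒*∣ {a} {b} a⊥b (divides q refl) b∣qa =
  subst (a * b ∣_) (*-comm a q) (*-monoʳ-∣ a (coprime-divisor (Coprime.sym a⊥b) (subst (b ∣_) (*-comm q a) b∣qa)))

distinct-primes⇒coprime : ∀ {p q} → Prime p → Prime q → p ≢ q → Coprime p q
distinct-primes⇒coprime p-prime q-prime p≢q {x} (x∣p , x∣q)
  with prime⇒irreducible p-prime x∣p | prime⇒irreducible q-prime x∣q
... | inj₁ x≡1 | _         = x≡1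
... | inj₂ _   | inj₁ x≡1  = x≡1
... | inj₂ refl | inj₂ refl = ⊥-elim (p≢q refl)

-- Prime-by-prime form of Rad x ^ j ∣ M (see Rad^∣); Squarefull x is definitionally RadPow∣ 2 x x.
RadPow∣ : ℕ → ℕ → ℕ → Set
RadPow∣ j x M = ∀ p → Prime p → p ∣ x → p ^ j ∣ M

RadPow∣-* : ∀ {j x y M} → RadPow∣ j x M → RadPow∣ j y M → RadPow∣ j (x * y) M
RadPow∣-* {x = x} {y} hx hy p p-prime p∣xy with euclidsLemma x y p-prime p∣xy
... | inj₁ p∣x = hx p p-prime p∣x
... | inj₂ p∣y = hy p p-prime p∣y

RadPow∣-^ : ∀ {j x M} i → RadPow∣ j x M → RadPow∣ j (x ^ i) M
RadPow∣-^ i hx p p-prime p∣x^i = hx p p-prime (prime∣^⇒prime∣ i p-prime p∣x^i)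

RadPow∣-∣ˡ : ∀ {j x y M} → x ∣ y → RadPow∣ j y M → RadPow∣ j x M
RadPow∣-∣ˡ x∣y hy p p-prime p∣x = hy p p-prime (∣-trans p∣x x∣y)

RadPow∣-∣ʳ : ∀ {j x M M′} → M ∣ M′ → RadPow∣ j x M → RadPow∣ j x M′
RadPow∣-∣ʳ M∣M′ hx p p-prime p∣x = ∣-trans (hx p p-prime p∣x) M∣M′

^∣⇒RadPow∣ : ∀ {j x M} → x ^ j ∣ M → RadPow∣ j x M
^∣⇒RadPow∣ {j} x^j∣M p _ p∣x = ∣-trans (^-monoˡ-∣ j p∣x) x^j∣M

primeDivisors : ℕ → List ℕ
primeDivisors n = filter (λ p → prime? p ×-dec (p ∣? n)) (upTo (suc n))

primeDivisors-prime-∣ : ∀ n → All (λ p → Prime p × p ∣ n) (primeDivisors n)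
primeDivisors-prime-∣ n = all-filter (λ p → prime? p ×-dec (p ∣? n)) (upTo (suc n))

primeDivisors-distinct : ∀ n → AllPairs _≢_ (primeDivisors n)
primeDivisors-distinct n = Unique.filter⁺ (λ p → prime? p ×-dec (p ∣? n)) (Unique.upTo⁺ (suc n))

coprime-product : ∀ {p ps} → Prime p → All Prime ps → All (p ≢_) ps → Coprime p (product ps)
coprime-product {p} p-prime []                  []              = Coprime.sym (1-coprimeTo p)
coprime-product     p-prime (q-prime ∷ primes) (p≢q ∷ p≢rest) =
  coprime-*ʳ (distinct-primes⇒coprime p-prime q-prime p≢q) (coprime-product p-prime primes p≢rest)

product-distinct-primes-^∣ : ∀ {j M ps} → AllPairs _≢_ ps → All Prime ps → All (λ p → p ^ j ∣ M) ps →
                             product ps ^ j ∣ M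
product-distinct-primes-^∣ {j} {M} [] [] [] = subst (_∣ M) (sym (^-zeroˡ j)) (1∣ M)
product-distinct-primes-^∣ {j} {M} {p ∷ ps} (p≢ps ∷ distinct) (p-prime ∷ primes) (p^j∣M ∷ ps^j∣M) =
  subst (_∣ M) (sym (^-distribʳ-* p (product ps) j))
    (coprime⇒*∣ (coprime-^ j j (coprime-product p-prime primes p≢ps)) p^j∣M
                (product-distinct-primes-^∣ {j} distinct primes ps^j∣M))

Rad^∣ : ∀ {j x M} → RadPow∣ j x M → Rad x ^ j ∣ M
Rad^∣ {j} {x} hx = product-distinct-primes-^∣ {j} (primeDivisors-distinct x)
  (All.map proj₁ (primeDivisors-prime-∣ x))
  (All.map (λ (p-prime , p∣x) → hx _ p-prime p∣x) (primeDivisors-prime-∣ x))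

squarefull-* : ∀ {x y} → Squarefull x → Squarefull y → Squarefull (x * y)
squarefull-* {x} {y} sx sy = RadPow∣-* {2} (RadPow∣-∣ʳ {2} (m∣m*n y) sx) (RadPow∣-∣ʳ {2} (n∣m*n x) sy)

squarefull-^2 : ∀ Q → Squarefull (Q ^ 2)
squarefull-^2 Q = RadPow∣-^ {2} {Q} 2 (^∣⇒RadPow∣ {2} ∣-refl)

squarefull-^2*∣ : ∀ {Q x} → x ∣ Q → Squarefull (Q ^ 2 * x)
squarefull-^2*∣ {Q} {x} x∣Q =
  RadPow∣-* {2} (RadPow∣-∣ʳ {2} (m∣m*n x) (squarefull-^2 Q)) (RadPow∣-∣ˡ {2} x∣Q (^∣⇒RadPow∣ {2} (m∣m*n x)))

squarefullAP-≤ : ∀ {m m′ N d} → m′ ≤ m → SquarefullAP m N d → SquarefullAP m′ N d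
squarefullAP-≤ {N = N} {d} m′≤m ap i =
  subst (λ j → Squarefull (N + j * d)) (FinP.toℕ-inject≤ i m′≤m) (ap (Fin.inject≤ i m′≤m))

-- The upper bound

-- If a and a + 1 are squarefull, so are 4a(a + 1) and 4a(a + 1) + 1 = (2a + 1)².
squarefullPair : ℕ → ℕ
squarefullPair zero    = 8
squarefullPair (suc j) = 4 * squarefullPair j * (squarefullPair j + 1)

squarefullPair-squarefull : ∀ j → Squarefull (squarefullPair j) × Squarefull (squarefullPair j + 1)
squarefullPair-squarefull zero = squarefull-^2*∣ {2} {2} ∣-refl , squarefull-^2 3
squarefullPair-squarefull (suc j) with squarefullPair-squarefull j
... | sa , sa+1 =
  squarefull-* (squarefull-* (squarefull-^2 2) sa) sa+1 ,
  subst Squarefull (square-eq (squarefullPair j)) (squarefull-^2 (2 * squarefullPair j + 1))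
  where
  square-eq : ∀ a → (2 * a + 1) ^ 2 ≡ 4 * a * (a + 1) + 1
  square-eq = solve 1 (λ a → (con 2 :* a :+ con 1) :^ 2 := con 4 :* a :* (a :+ con 1) :+ con 1) refl

squarefullPair-> : ∀ j → j < squarefullPair j
squarefullPair-> zero    = s≤s z≤n
squarefullPair-> (suc j) = begin-strict
  suc j                 ≤⟨ squarefullPair-> j ⟩
  a                     <⟨ n<1+n a ⟩
  suc a                 ≡⟨ +-comm 1 a ⟩
  a + 1                 ≤⟨ m≤n*m (a + 1) (4 * a) {{m*n≢0 4 a {{_}} {{>-nonZero (≤-trans (s≤s z≤n) (squarefullPair-> j))}}}} ⟩
  4 * a * (a + 1)       ∎
  where
  open ≤-Reasoning
  a : ℕ
  a = squarefullPair j

∏< : ℕ → (ℕ → ℕ) → ℕ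
∏< zero    f = 1
∏< (suc t) f = f t * ∏< t f

∏<-∣ : ∀ f {i t} → i < t → f i ∣ ∏< t f
∏<-∣ f {i} {suc t} i<1+t with i ≟ t
... | yes refl = m∣m*n (∏< t f)
... | no  i≢t  = ∣n⇒∣m*n (f t) (∏<-∣ f (≤∧≢⇒< (≤-pred i<1+t) i≢t))

∏<-≤ : ∀ {b} t f → (∀ i → i < t → f i ≤ b) → ∏< t f ≤ b ^ t
∏<-≤ zero    f _   = ≤-refl
∏<-≤ (suc t) f f≤b = *-mono-≤ (f≤b t ≤-refl) (∏<-≤ t f (λ i i<t → f≤b i (m<n⇒m<1+n i<t)))

∏<-positive : ∀ t f → (∀ i → i < t → 1 ≤ f i) → 1 ≤ ∏< t f
∏<-positive zero    f _   = ≤-refl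
∏<-positive (suc t) f f≥1 = *-mono-≤ (f≥1 t ≤-refl) (∏<-positive t f (λ i i<t → f≥1 i (m<n⇒m<1+n i<t)))

squarefullAP-Q²a : ∀ {a Q} t → Squarefull a → Squarefull (a + 1) → (∀ i → i < t → a + (2 + i) ∣ Q) →
                   SquarefullAP (2 + t) (Q ^ 2 * a) (Q ^ 2)
squarefullAP-Q²a {a} {Q} t sa sa+1 Q-divisible i =
  subst Squarefull (trans (*-distribˡ-+ (Q ^ 2) a (toℕ i)) (cong (Q ^ 2 * a +_) (*-comm (Q ^ 2) (toℕ i))))
    (squarefull-term i)
  where
  squarefull-term : ∀ (i : Fin (2 + t)) → Squarefull (Q ^ 2 * (a + toℕ i))
  squarefull-term Fin.zero             = subst (λ x → Squarefull (Q ^ 2 * x)) (sym (+-identityʳ a))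
                                           (squarefull-* (squarefull-^2 Q) sa)
  squarefull-term (Fin.suc Fin.zero)    = squarefull-* (squarefull-^2 Q) sa+1
  squarefull-term (Fin.suc (Fin.suc i)) = squarefull-^2*∣ (Q-divisible (toℕ i) (FinP.toℕ<n i))

[2a]^k≤a^1+k : ∀ {a} k → 2 ^ k ≤ a → (2 * a) ^ k ≤ a ^ suc k
[2a]^k≤a^1+k {a} k 2^k≤a = begin
  (2 * a) ^ k   ≡⟨ ^-distribʳ-* 2 a k ⟩
  2 ^ k * a ^ k ≤⟨ *-monoˡ-≤ (a ^ k) 2^k≤a ⟩
  a * a ^ k     ∎
  where open ≤-Reasoning

shiftedProduct-^-≤ : ∀ {a} t k → 2 + t ≤ a → 2 ^ k ≤ a → ∏< t (λ i → a + (2 + i)) ^ k ≤ a ^ (suc k * t)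
shiftedProduct-^-≤ {a} t k 2+t≤a 2^k≤a = begin
  ∏< t (λ i → a + (2 + i)) ^ k ≤⟨ ^-monoˡ-≤ k (∏<-≤ t (λ i → a + (2 + i)) factor≤2a) ⟩
  ((2 * a) ^ t) ^ k            ≡⟨ ^-*-comm (2 * a) t k ⟩
  ((2 * a) ^ k) ^ t            ≤⟨ ^-monoˡ-≤ t ([2a]^k≤a^1+k k 2^k≤a) ⟩
  (a ^ suc k) ^ t              ≡⟨ ^-*-assoc a (suc k) t ⟩
  a ^ (suc k * t)              ∎
  where
  open ≤-Reasoning
  factor≤2a : ∀ i → i < t → a + (2 + i) ≤ 2 * a
  factor≤2a i i<t = begin
    a + (2 + i) ≤⟨ +-monoʳ-≤ a (≤-trans (+-monoʳ-≤ 2 (<⇒≤ i<t)) 2+t≤a) ⟩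
    a + a       ≡⟨ cong (a +_) (sym (+-identityʳ a)) ⟩
    2 * a       ∎

Q^k≤⇒[Q²]^≤[Q²a]^ : ∀ {a Q} t k → 1 ≤ a → 1 ≤ Q → Q ^ k ≤ a ^ (suc k * t) →
                  (Q ^ 2) ^ ((2 * t + 1) * k) ≤ (Q ^ 2 * a) ^ (2 * t * k + (2 * t + 1))
Q^k≤⇒[Q²]^≤[Q²a]^ {a} {Q} t k a≥1 Q≥1 Q^k≤ = begin
  (Q ^ 2) ^ ((2 * t + 1) * k)           ≡⟨ cong ((Q ^ 2) ^_) (solve 2 (λ t k → (con 2 :* t :+ con 1) :* k := con 2 :* t :* k :+ k) refl t k) ⟩
  (Q ^ 2) ^ (2 * t * k + k)             ≡⟨ ^-distribˡ-+-* (Q ^ 2) (2 * t * k) k ⟩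
  (Q ^ 2) ^ (2 * t * k) * (Q ^ 2) ^ k   ≡⟨ cong ((Q ^ 2) ^ (2 * t * k) *_) (^-*-comm Q 2 k) ⟩
  (Q ^ 2) ^ (2 * t * k) * (Q ^ k) ^ 2   ≤⟨ *-monoʳ-≤ ((Q ^ 2) ^ (2 * t * k)) (^-monoˡ-≤ 2 Q^k≤) ⟩
  (Q ^ 2) ^ (2 * t * k) * (a ^ (suc k * t)) ^ 2
    ≡⟨ cong ((Q ^ 2) ^ (2 * t * k) *_) (trans (^-*-assoc a (suc k * t) 2)
         (cong (a ^_) (solve 2 (λ t k → (con 1 :+ k) :* t :* con 2 := con 2 :* t :* k :+ con 2 :* t) refl t k))) ⟩
  (Q ^ 2) ^ (2 * t * k) * a ^ (2 * t * k + 2 * t)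
    ≤⟨ *-mono-≤ (^-monoʳ-≤ (Q ^ 2) {{m^n≢0 Q 2 {{>-nonZero Q≥1}}}} (m≤m+n (2 * t * k) (2 * t + 1)))
                (^-monoʳ-≤ a {{>-nonZero a≥1}} (+-monoʳ-≤ (2 * t * k) (m≤m+n (2 * t) 1))) ⟩
  (Q ^ 2) ^ e * a ^ e                   ≡⟨ sym (^-distribʳ-* (Q ^ 2) a e) ⟩
  (Q ^ 2 * a) ^ e                       ∎
  where
  open ≤-Reasoning
  e : ℕ
  e = 2 * t * k + (2 * t + 1)

thetaUpper : ∀ t → ThetaUpper (2 + t)
thetaUpper t k _ N₀ =
  Q ^ 2 * a , Q ^ 2 , N₀≤N , m^n>0 Q 2 , squarefullAP-Q²a t sa sa+1 (λ i → ∏<-∣ (λ i → a + (2 + i))) , bound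
  where
  j a Q : ℕ
  j = N₀ + (2 + t) + 2 ^ k
  a = squarefullPair j
  Q = ∏< t (λ i → a + (2 + i))
  j≤a : j ≤ a
  j≤a = <⇒≤ (squarefullPair-> j)
  N₀≤a : N₀ ≤ a
  N₀≤a = ≤-trans (≤-trans (m≤m+n N₀ (2 + t)) (m≤m+n (N₀ + (2 + t)) (2 ^ k))) j≤a
  2+t≤a : 2 + t ≤ a
  2+t≤a = ≤-trans (≤-trans (m≤n+m (2 + t) N₀) (m≤m+n (N₀ + (2 + t)) (2 ^ k))) j≤a
  2^k≤a : 2 ^ k ≤ a
  2^k≤a = ≤-trans (m≤n+m (2 ^ k) (N₀ + (2 + t))) j≤a
  sa : Squarefull a
  sa = proj₁ (squarefullPair-squarefull j)
  sa+1 : Squarefull (a + 1)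
  sa+1 = proj₂ (squarefullPair-squarefull j)
  instance
    Q≢0 : NonZero Q
    Q≢0 = >-nonZero (∏<-positive t (λ i → a + (2 + i)) (λ i _ → ≤-trans (s≤s z≤n) (m≤n+m (2 + i) a)))
  N₀≤N : N₀ ≤ Q ^ 2 * a
  N₀≤N = ≤-trans N₀≤a (m≤n*m a (Q ^ 2) {{m^n≢0 Q 2}})
  2t+1≡ : 2 * (2 + t) ∸ 3 ≡ 2 * t + 1
  2t+1≡ = trans (cong (_∸ 3) (solve 1 (λ t → con 2 :* (con 2 :+ t) := con 3 :+ (con 2 :* t :+ con 1)) refl t))
                (m+n∸m≡n 3 (2 * t + 1))
  2t≡ : 2 * (2 + t) ∸ 4 ≡ 2 * t
  2t≡ = trans (cong (_∸ 4) (solve 1 (λ t → con 2 :* (con 2 :+ t) := con 4 :+ con 2 :* t) refl t)) (m+n∸m≡n 4 (2 * t))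
  bound : (Q ^ 2) ^ ((2 * (2 + t) ∸ 3) * k) ≤ (Q ^ 2 * a) ^ ((2 * (2 + t) ∸ 4) * k + (2 * (2 + t) ∸ 3))
  bound rewrite 2t+1≡ | 2t≡ =
    Q^k≤⇒[Q²]^≤[Q²a]^ t k (≤-trans (s≤s z≤n) 2+t≤a) (>-nonZero⁻¹ Q) (shiftedProduct-^-≤ t k 2+t≤a 2^k≤a)

-- abc triples from squarefull progressions

gcd-cofactors : ∀ m n → n > 0 → ∃[ m′ ] ∃[ n′ ] (m ≡ m′ * gcd m n × n ≡ n′ * gcd m n × Coprime m′ n′)
gcd-cofactors m n n>0 with gcd[m,n]∣m m n | gcd[m,n]∣n m n
... | divides m′ m≡m′g | divides n′ n≡n′g =
  m′ , n′ , m≡m′g , n≡n′g , subst₂ Coprime (cofactor m≡m′g) (cofactor n≡n′g) (coprime-/gcd m n)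
  where
  instance
    gcd≢0 : NonZero (gcd m n)
    gcd≢0 = ≢-nonZero (gcd[m,n]≢0 m n (inj₂ (n>0⇒n≢0 n>0)))
  cofactor : ∀ {x y} → x ≡ y * gcd m n → x / gcd m n ≡ y
  cofactor {y = y} x≡yg = trans (/-congˡ x≡yg) (m*n/n≡m y (gcd m n))

-- The abc inequality for A/g + B/g = (A + B)/g with g = gcd A B, squared so that Rad² ≤ M can be used.
AbcBound : ℕ → ℕ → Set
AbcBound k K = ∀ A B M → 1 ≤ A → 1 ≤ B → 1 ≤ M → RadPow∣ 2 (A * B * (A + B)) M →
               (A + B) ^ (2 * k) ≤ gcd A B ^ (2 * k) * (K ^ 2 * M ^ (k + 1))

abc⇒AbcBound : ABC → ∀ k → 1 ≤ k → ∃[ K ] AbcBound k K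
abc⇒AbcBound abc k k≥1 with abc k k≥1
... | K , abc-k = K , bound
  where
  bound : AbcBound k K
  bound A B M A≥1 B≥1 M≥1 radSq with gcd-cofactors A B B≥1
  ... | A′ , B′ , A≡A′g , B≡B′g , A′⊥B′ = begin
    (A + B) ^ (2 * k)                   ≡⟨ cong (_^ (2 * k)) A+B≡C′g ⟩
    (C′ * g) ^ (2 * k)                  ≡⟨ trans (^-distribʳ-* C′ g (2 * k)) (*-comm (C′ ^ (2 * k)) (g ^ (2 * k))) ⟩
    g ^ (2 * k) * C′ ^ (2 * k)          ≤⟨ *-monoʳ-≤ (g ^ (2 * k)) C′^2k≤ ⟩
    g ^ (2 * k) * (K ^ 2 * M ^ (k + 1)) ∎
    where
    open ≤-Reasoning
    g C′ R : ℕ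
    g  = gcd A B
    C′ = A′ + B′
    R  = Rad (A′ * B′ * C′)
    A+B≡C′g : A + B ≡ C′ * g
    A+B≡C′g = trans (cong₂ _+_ A≡A′g B≡B′g) (sym (*-distribʳ-+ g A′ B′))
    cofactor∣ : ∀ {x} y → x ≡ y * g → y ∣ x
    cofactor∣ y x≡yg = divides g (trans x≡yg (*-comm y g))
    A′B′C′∣ABC : A′ * B′ * C′ ∣ A * B * (A + B)
    A′B′C′∣ABC = *-pres-∣ (*-pres-∣ (cofactor∣ A′ A≡A′g) (cofactor∣ B′ B≡B′g)) (cofactor∣ C′ A+B≡C′g)
    R²≤M : R ^ 2 ≤ M
    R²≤M = ∣⇒≤ {{>-nonZero M≥1}} (Rad^∣ {2} (RadPow∣-∣ˡ {2} A′B′C′∣ABC radSq))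
    C′^2k≤ : C′ ^ (2 * k) ≤ K ^ 2 * M ^ (k + 1)
    C′^2k≤ = begin
      C′ ^ (2 * k)                ≡⟨ trans (cong (C′ ^_) (*-comm 2 k)) (sym (^-*-assoc C′ k 2)) ⟩
      (C′ ^ k) ^ 2                ≤⟨ ^-monoˡ-≤ 2 (<⇒≤ (abc-k A′ B′ C′ (m*n>0⇒m>0 (subst (1 ≤_) A≡A′g A≥1))
                                                       (m*n>0⇒m>0 (subst (1 ≤_) B≡B′g B≥1)) A′⊥B′ refl)) ⟩
      (K * R ^ (k + 1)) ^ 2       ≡⟨ trans (^-distribʳ-* K (R ^ (k + 1)) 2) (cong (K ^ 2 *_) (^-*-comm R (k + 1) 2)) ⟩
      K ^ 2 * (R ^ 2) ^ (k + 1)   ≤⟨ *-monoʳ-≤ (K ^ 2) (^-monoˡ-≤ (k + 1) R²≤M) ⟩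
      K ^ 2 * M ^ (k + 1)         ∎

record ReducedSquarefullAP (m n e h : ℕ) : Set where
  field
    coprime    : Coprime n e
    e≥1        : 1 ≤ e
    e≤n        : e ≤ n
    h≥1        : 1 ≤ h
    squarefull : (i : Fin m) → Squarefull ((n + toℕ i * e) * h)

  n≥1 : 1 ≤ n
  n≥1 = ≤-trans e≥1 e≤n

reduce-squarefullAP : ∀ {m N d} → 1 ≤ d → d < N → SquarefullAP m N d →
                      ∃[ n ] ∃[ e ] ∃[ h ] (N ≡ n * h × d ≡ e * h × ReducedSquarefullAP m n e h)
reduce-squarefullAP {N = N} {d} d≥1 d<N ap with gcd-cofactors N d d≥1
... | n , e , N≡nh , d≡eh , n⊥e = n , e , h , N≡nh , d≡eh , record
  { coprime    = n⊥e
  ; e≥1        = m*n>0⇒m>0 (subst (1 ≤_) d≡eh d≥1)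
  ; e≤n        = <⇒≤ (*-cancelʳ-< h e n (subst₂ _<_ d≡eh N≡nh d<N))
  ; h≥1        = n≢0⇒n>0 (gcd[m,n]≢0 N d (inj₂ (n>0⇒n≢0 d≥1)))
  ; squarefull = λ i → subst Squarefull (term≡ (toℕ i)) (ap i)
  }
  where
  h : ℕ
  h = gcd N d
  term≡ : ∀ i → N + i * d ≡ (n + i * e) * h
  term≡ i = trans (cong₂ (λ x y → x + i * y) N≡nh d≡eh)
                  (solve 4 (λ n e h i → n :* h :+ i :* (e :* h) := (n :+ i :* e) :* h) refl n e h i)

coprime-term : ∀ {n e} → Coprime n e → ∀ i → Coprime (n + i * e) e
coprime-term {n} {e} n⊥e i {x} (x∣term , x∣e) =
  n⊥e (∣m+n∣m⇒∣n (subst (x ∣_) (+-comm n (i * e)) x∣term) (∣n⇒∣m*n i x∣e) , x∣e)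

∣-terms⇒∣-gap : ∀ {n e x} i t → Coprime n e → x ∣ n + i * e → x ∣ n + (i + t) * e → x ∣ t
∣-terms⇒∣-gap {n} {e} {x} i t n⊥e x∣zᵢ x∣zᵢ₊ₜ =
  coprime-divisor (coprime-∣ˡ (coprime-term n⊥e i) x∣zᵢ) (∣m+n∣m⇒∣n (subst (x ∣_) split x∣zᵢ₊ₜ) x∣zᵢ)
  where
  split : n + (i + t) * e ≡ n + i * e + e * t
  split = solve 4 (λ n e i t → n :+ (i :+ t) :* e := n :+ i :* e :+ e :* t) refl n e i t

coprime-adjacent-terms : ∀ {n e} → Coprime n e → ∀ i → Coprime (n + i * e) (n + (i + 1) * e)
coprime-adjacent-terms n⊥e i (x∣zᵢ , x∣zᵢ₊₁) = ∣1⇒≡1 (∣-terms⇒∣-gap i 1 n⊥e x∣zᵢ x∣zᵢ₊₁)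

term≤ : ∀ {n e i m} → e ≤ n → i < m → n + i * e ≤ m * n
term≤ {n} {i = i} e≤n i<m = ≤-trans (+-monoʳ-≤ n (*-monoʳ-≤ i e≤n)) (*-monoˡ-≤ n i<m)

^-+-mod : ∀ y c j → ∃[ q ] ((y + c) ^ j ≡ q * y + c ^ j)
^-+-mod y c zero    = 0 , refl
^-+-mod y c (suc j) with ^-+-mod y c j
... | q , eq = (y + c) * q + c ^ j , trans (cong ((y + c) *_) eq)
  (solve 4 (λ y c q r → (y :+ c) :* (q :* y :+ r) := ((y :+ c) :* q :+ r) :* y :+ c :* r) refl y c q (c ^ j))

∣-+-^⇒∣-^ : ∀ {d y} c j → d ∣ y → d ∣ (y + c) ^ j → d ∣ c ^ j
∣-+-^⇒∣-^ {d} {y} c j d∣y d∣[y+c]^j with ^-+-mod y c j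
... | q , eq = ∣m+n∣m⇒∣n (subst (d ∣_) eq d∣[y+c]^j) (∣n⇒∣m*n q d∣y)

module SquareCover {m n e h} (ap : ReducedSquarefullAP m n e h) (R : ℕ) where
  open ReducedSquarefullAP ap

  P M : ℕ
  P = ∏< m (λ i → n + i * e)
  M = P * h * (e * R) ^ 2

  term-RadPow∣ : (i : Fin m) → RadPow∣ 2 (n + toℕ i * e) M
  term-RadPow∣ i = RadPow∣-∣ʳ {2} (∣m⇒∣m*n ((e * R) ^ 2) (*-monoˡ-∣ h (∏<-∣ (λ i → n + i * e) (FinP.toℕ<n i))))
                     (RadPow∣-∣ˡ {2} (m∣m*n h) (squarefull i))

  eR-RadPow∣ : RadPow∣ 2 (e * R) M
  eR-RadPow∣ = ^∣⇒RadPow∣ {2} (n∣m*n (P * h))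

  e-RadPow∣ : RadPow∣ 2 e M
  e-RadPow∣ = RadPow∣-∣ˡ {2} (m∣m*n R) eR-RadPow∣

  R-RadPow∣ : RadPow∣ 2 R M
  R-RadPow∣ = RadPow∣-∣ˡ {2} (n∣m*n e) eR-RadPow∣

  M≥1 : 1 ≤ R → 1 ≤ M
  M≥1 R≥1 = *-mono-≤ (*-mono-≤ (∏<-positive m (λ i → n + i * e) (λ i _ → ≤-trans n≥1 (m≤m+n n (i * e)))) h≥1)
                     (*-mono-≤ (*-mono-≤ e≥1 R≥1) (*-mono-≤ (*-mono-≤ e≥1 R≥1) ≤-refl))

  M≤ : ∀ {r} → R ≤ r → M ≤ (m * n) ^ m * h * (e * r) ^ 2
  M≤ R≤r = *-mono-≤ (*-monoˡ-≤ h (∏<-≤ m (λ i → n + i * e) (λ i i<m → term≤ e≤n i<m)))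
                    (^-monoˡ-≤ 2 (*-monoʳ-≤ e R≤r))

record AbcTriple (α β G c n e h : ℕ) : Set where
  field
    A B M  : ℕ
    A≥1    : 1 ≤ A
    B≥1    : 1 ≤ B
    M≥1    : 1 ≤ M
    radSq  : RadPow∣ 2 (A * B * (A + B)) M
    gcd∣   : gcd A B ∣ G
    n^α≤   : n ^ α ≤ A + B
    M≤     : M ≤ c * (h * e ^ 2) * n ^ β

AbcTriple⇒bound : ∀ {k K α β G c n e h} u → AbcBound k K → 1 ≤ n → 1 ≤ G → AbcTriple α β G c n e h →
                  u + β * (k + 1) ≤ α * (2 * k) →
                  n ^ u ≤ G ^ (2 * k) * K ^ 2 * c ^ (k + 1) * (h * e ^ 2) ^ (k + 1)
AbcTriple⇒bound {k} {K} {α} {β} {G} {c} {n} {e} {h} u abc-bound n≥1 G≥1 triple exponents =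
  *-cancelʳ-≤ (n ^ u) X (n ^ (β * (k + 1))) {{m^n≢0 n (β * (k + 1)) {{>-nonZero n≥1}}}} (begin
    n ^ u * n ^ (β * (k + 1))                   ≡⟨ sym (^-distribˡ-+-* n u (β * (k + 1))) ⟩
    n ^ (u + β * (k + 1))                       ≤⟨ ^-monoʳ-≤ n {{>-nonZero n≥1}} exponents ⟩
    n ^ (α * (2 * k))                           ≡⟨ sym (^-*-assoc n α (2 * k)) ⟩
    (n ^ α) ^ (2 * k)                           ≤⟨ ^-monoˡ-≤ (2 * k) n^α≤ ⟩
    (A + B) ^ (2 * k)                           ≤⟨ abc-bound A B M A≥1 B≥1 M≥1 radSq ⟩
    gcd A B ^ (2 * k) * (K ^ 2 * M ^ (k + 1))   ≤⟨ *-mono-≤ (^-monoˡ-≤ (2 * k) (∣⇒≤ {{>-nonZero G≥1}} gcd∣))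
                                                            (*-monoʳ-≤ (K ^ 2) (^-monoˡ-≤ (k + 1) M≤)) ⟩
    G ^ (2 * k) * (K ^ 2 * (c * E * n ^ β) ^ (k + 1))
      ≡⟨ cong (λ x → G ^ (2 * k) * (K ^ 2 * x)) (trans (^-distribʳ-* (c * E) (n ^ β) (k + 1))
           (cong₂ _*_ (^-distribʳ-* c E (k + 1)) (^-*-assoc n β (k + 1)))) ⟩
    G ^ (2 * k) * (K ^ 2 * (c ^ (k + 1) * E ^ (k + 1) * n ^ (β * (k + 1))))
      ≡⟨ solve 5 (λ g k c e n → g :* (k :* (c :* e :* n)) := g :* k :* c :* e :* n) refl
           (G ^ (2 * k)) (K ^ 2) (c ^ (k + 1)) (E ^ (k + 1)) (n ^ (β * (k + 1))) ⟩
    X * n ^ (β * (k + 1))                       ∎)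
  where
  open ≤-Reasoning
  open AbcTriple triple
  E X : ℕ
  E = h * e ^ 2
  X = G ^ (2 * k) * K ^ 2 * c ^ (k + 1) * E ^ (k + 1)

n^u≤⇒[nh]^u≤ : ∀ {n h e X u v w} → 1 ≤ h → 1 ≤ e → n ^ u ≤ X * (h * e ^ 2) ^ v → u + v ≤ w → 2 * v ≤ w →
               (n * h) ^ u ≤ X * (e * h) ^ w
n^u≤⇒[nh]^u≤ {n} {h} {e} {X} {u} {v} {w} h≥1 e≥1 n^u≤ u+v≤w 2v≤w = begin
  (n * h) ^ u                          ≡⟨ ^-distribʳ-* n h u ⟩
  n ^ u * h ^ u                        ≤⟨ *-monoˡ-≤ (h ^ u) n^u≤ ⟩
  X * (h * e ^ 2) ^ v * h ^ u          ≡⟨ cong (λ x → X * x * h ^ u) (trans (^-distribʳ-* h (e ^ 2) v) (cong (h ^ v *_) (^-*-assoc e 2 v))) ⟩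
  X * (h ^ v * e ^ (2 * v)) * h ^ u    ≡⟨ solve 4 (λ X a b c → X :* (a :* b) :* c := X :* (b :* (c :* a))) refl X (h ^ v) (e ^ (2 * v)) (h ^ u) ⟩
  X * (e ^ (2 * v) * (h ^ u * h ^ v))  ≡⟨ cong (λ x → X * (e ^ (2 * v) * x)) (sym (^-distribˡ-+-* h u v)) ⟩
  X * (e ^ (2 * v) * h ^ (u + v))      ≤⟨ *-monoʳ-≤ X (*-mono-≤ (^-monoʳ-≤ e {{>-nonZero e≥1}} 2v≤w) (^-monoʳ-≤ h {{>-nonZero h≥1}} u+v≤w)) ⟩
  X * (e ^ w * h ^ w)                  ≡⟨ cong (X *_) (sym (^-distribʳ-* e h w)) ⟩
  X * (e * h) ^ w                      ∎
  where open ≤-Reasoning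

module FourTerms {n e h} (ap : ReducedSquarefullAP 4 n e h) where
  open ReducedSquarefullAP ap

  z : ℕ → ℕ
  z i = n + i * e

  R A B C : ℕ
  R = 2 * n + 3 * e
  A = z 0 * z 2 ^ 3
  B = e ^ 3 * R
  C = z 1 ^ 3 * z 3

  open SquareCover ap R

  A+B≡C : A + B ≡ C
  A+B≡C = solve 2 (λ n e → (n :+ con 0 :* e) :* (n :+ con 2 :* e) :^ 3 :+ e :^ 3 :* (con 2 :* n :+ con 3 :* e)
                          := (n :+ con 1 :* e) :^ 3 :* (n :+ con 3 :* e)) refl n e

  z≥1 : ∀ i → 1 ≤ z i
  z≥1 i = ≤-trans n≥1 (m≤m+n n (i * e))

  R≥1 : 1 ≤ R
  R≥1 = ≤-trans (z≥1 0) (+-mono-≤ (m≤m+n n (n + 0)) z≤n)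

  R≤5n : R ≤ 5 * n
  R≤5n = begin
    2 * n + 3 * e ≤⟨ +-monoʳ-≤ (2 * n) (*-monoʳ-≤ 3 e≤n) ⟩
    2 * n + 3 * n ≡⟨ solve 1 (λ n → con 2 :* n :+ con 3 :* n := con 5 :* n) refl n ⟩
    5 * n         ∎
    where open ≤-Reasoning

  M≤cE*n⁶ : M ≤ 4 ^ 4 * 5 ^ 2 * (h * e ^ 2) * n ^ 6
  M≤cE*n⁶ = ≤-trans (M≤ R≤5n) (≤-reflexive (shape 4 5))
    where
    shape : ∀ a b → (a * n) ^ 4 * h * (e * (b * n)) ^ 2 ≡ a ^ 4 * b ^ 2 * (h * e ^ 2) * n ^ 6
    shape = solve 5 (λ n h e a b → (a :* n) :^ 4 :* h :* (e :* (b :* n)) :^ 2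
                                  := a :^ 4 :* b :^ 2 :* (h :* e :^ 2) :* n :^ 6) refl n h e

  n⁴≤C : n ^ 4 ≤ C
  n⁴≤C = begin
    n ^ 4     ≡⟨ solve 1 (λ n → n :^ 4 := n :^ 3 :* n) refl n ⟩
    n ^ 3 * n ≤⟨ *-mono-≤ (^-monoˡ-≤ 3 (m≤m+n n (1 * e))) (m≤m+n n (3 * e)) ⟩
    C         ∎
    where open ≤-Reasoning

  ABC-cover : RadPow∣ 2 (A * B * C) M
  ABC-cover = RadPow∣-* {2} (RadPow∣-* {2} A-cover B-cover) C-cover
    where
    A-cover : RadPow∣ 2 A M
    A-cover = RadPow∣-* {2} (term-RadPow∣ (# 0)) (RadPow∣-^ {2} 3 (term-RadPow∣ (# 2)))
    B-cover : RadPow∣ 2 B M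
    B-cover = RadPow∣-* {2} (RadPow∣-^ {2} 3 e-RadPow∣) R-RadPow∣
    C-cover : RadPow∣ 2 C M
    C-cover = RadPow∣-* {2} (RadPow∣-^ {2} 3 (term-RadPow∣ (# 1))) (term-RadPow∣ (# 3))

  gcd∣3 : gcd A B ∣ 3
  gcd∣3 = ∣-terms⇒∣-gap 0 3 coprime g∣z₀ g∣z₃
    where
    adjacent : ∀ i → Coprime (z i) (z (i + 1))
    adjacent = coprime-adjacent-terms coprime
    g∣A : gcd A B ∣ A
    g∣A = gcd[m,n]∣m A B
    g∣C : gcd A B ∣ C
    g∣C = subst (gcd A B ∣_) A+B≡C (∣m∣n⇒∣m+n g∣A (gcd[m,n]∣n A B))
    A⊥z₁ : Coprime A (z 1)
    A⊥z₁ = Coprime.sym (coprime-*ʳ (Coprime.sym (adjacent 0)) (coprime-^ʳ 3 (adjacent 1)))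
    g∣z₃ : gcd A B ∣ z 3
    g∣z₃ = coprime-divisor (coprime-∣ˡ (coprime-^ʳ 3 A⊥z₁) g∣A) g∣C
    g∣z₀ : gcd A B ∣ z 0
    g∣z₀ = coprime-divisor (coprime-∣ˡ (coprime-^ʳ 3 (Coprime.sym (adjacent 2))) g∣z₃)
                           (subst (gcd A B ∣_) (*-comm (z 0) (z 2 ^ 3)) g∣A)

  abcTriple : AbcTriple 4 6 3 (4 ^ 4 * 5 ^ 2) n e h
  abcTriple = record
    { A = A ; B = B ; M = M
    ; A≥1   = *-mono-≤ (z≥1 0) (^-monoˡ-≤ 3 (z≥1 2))
    ; B≥1   = *-mono-≤ (^-monoˡ-≤ 3 e≥1) R≥1
    ; M≥1   = M≥1 R≥1
    ; radSq = subst (λ x → RadPow∣ 2 (A * B * x) M) (sym A+B≡C) ABC-cover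
    ; gcd∣  = gcd∣3
    ; n^α≤  = subst (n ^ 4 ≤_) (sym A+B≡C) n⁴≤C
    ; M≤    = M≤cE*n⁶
    }

-- In y = z₀z₄ and s = e² the identity reads y(y + 4s)³ + s²R = (y + 3s)⁴, as z₂² = y + 4s and z₁z₃ = y + 3s.
module FiveTerms {n e h} (ap : ReducedSquarefullAP 5 n e h) where
  open ReducedSquarefullAP ap

  z : ℕ → ℕ
  z i = n + i * e

  y s R A B C : ℕ
  y = z 0 * z 4
  s = e ^ 2
  R = 6 * y ^ 2 + 44 * y * s + 81 * s ^ 2
  A = y * (y + 4 * s) ^ 3
  B = s ^ 2 * R
  C = (y + 3 * s) ^ 4

  open SquareCover ap R

  A+B≡C : A + B ≡ C
  A+B≡C = solve 2 (λ y s → y :* (y :+ con 4 :* s) :^ 3 :+ s :^ 2 :* (con 6 :* y :^ 2 :+ con 44 :* y :* s :+ con 81 :* s :^ 2)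
                          := (y :+ con 3 :* s) :^ 4) refl y s

  z₂²≡ : z 2 ^ 2 ≡ y + 4 * s
  z₂²≡ = solve 2 (λ n e → (n :+ con 2 :* e) :^ 2 := (n :+ con 0 :* e) :* (n :+ con 4 :* e) :+ con 4 :* e :^ 2) refl n e

  z₁z₃≡ : z 1 * z 3 ≡ y + 3 * s
  z₁z₃≡ = solve 2 (λ n e → (n :+ con 1 :* e) :* (n :+ con 3 :* e) := (n :+ con 0 :* e) :* (n :+ con 4 :* e) :+ con 3 :* e :^ 2) refl n e

  n²≤y : n ^ 2 ≤ y
  n²≤y = *-mono-≤ (m≤m+n n (0 * e)) (≤-trans (≤-reflexive (*-identityʳ n)) (m≤m+n n (4 * e)))

  y≥1 : 1 ≤ y
  y≥1 = ≤-trans (^-monoˡ-≤ 2 n≥1) n²≤y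

  s≥1 : 1 ≤ s
  s≥1 = ^-monoˡ-≤ 2 e≥1

  R≥1 : 1 ≤ R
  R≥1 = ≤-trans (*-mono-≤ {1} {81} (s≤s z≤n) (^-monoˡ-≤ 2 s≥1)) (m≤n+m (81 * s ^ 2) (6 * y ^ 2 + 44 * y * s))

  R≤451n⁴ : R ≤ 451 * n ^ 4
  R≤451n⁴ = begin
    6 * y ^ 2 + 44 * y * s + 81 * s ^ 2
      ≤⟨ +-mono-≤ (+-mono-≤ (*-monoʳ-≤ 6 (^-monoˡ-≤ 2 y≤)) (*-mono-≤ (*-monoʳ-≤ 44 y≤) s≤))
                  (*-monoʳ-≤ 81 (^-monoˡ-≤ 2 s≤)) ⟩
    6 * (1 * n * (5 * n)) ^ 2 + 44 * (1 * n * (5 * n)) * n ^ 2 + 81 * (n ^ 2) ^ 2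
      ≡⟨ solve 1 (λ n → con 6 :* (con 1 :* n :* (con 5 :* n)) :^ 2 :+ con 44 :* (con 1 :* n :* (con 5 :* n)) :* n :^ 2
                        :+ con 81 :* (n :^ 2) :^ 2 := con 451 :* n :^ 4) refl n ⟩
    451 * n ^ 4 ∎
    where
    open ≤-Reasoning
    y≤ : y ≤ 1 * n * (5 * n)
    y≤ = *-mono-≤ (term≤ {m = 1} e≤n (s≤s z≤n)) (term≤ {m = 5} e≤n (s≤s (s≤s (s≤s (s≤s (s≤s z≤n))))))
    s≤ : s ≤ n ^ 2
    s≤ = ^-monoˡ-≤ 2 e≤n

  M≤cE*n¹³ : M ≤ 5 ^ 5 * 451 ^ 2 * (h * e ^ 2) * n ^ 13
  M≤cE*n¹³ = ≤-trans (M≤ R≤451n⁴) (≤-reflexive (shape 5 451))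
    where
    shape : ∀ a b → (a * n) ^ 5 * h * (e * (b * n ^ 4)) ^ 2 ≡ a ^ 5 * b ^ 2 * (h * e ^ 2) * n ^ 13
    shape = solve 5 (λ n h e a b → (a :* n) :^ 5 :* h :* (e :* (b :* n :^ 4)) :^ 2
                                  := a :^ 5 :* b :^ 2 :* (h :* e :^ 2) :* n :^ 13) refl n h e

  n⁸≤C : n ^ 8 ≤ C
  n⁸≤C = subst (_≤ C) (^-*-assoc n 2 4) (^-monoˡ-≤ 4 (≤-trans n²≤y (m≤m+n y (3 * s))))

  ABC-cover : RadPow∣ 2 (A * B * C) M
  ABC-cover = RadPow∣-* {2} (RadPow∣-* {2} A-cover B-cover) C-cover
    where
    A-cover : RadPow∣ 2 A M
    A-cover = RadPow∣-* {2} (RadPow∣-* {2} (term-RadPow∣ (# 0)) (term-RadPow∣ (# 4)))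
                (RadPow∣-^ {2} 3 (subst (λ x → RadPow∣ 2 x M) z₂²≡ (RadPow∣-^ {2} 2 (term-RadPow∣ (# 2)))))
    B-cover : RadPow∣ 2 B M
    B-cover = RadPow∣-* {2} (RadPow∣-^ {2} 2 (RadPow∣-^ {2} 2 e-RadPow∣)) R-RadPow∣
    C-cover : RadPow∣ 2 C M
    C-cover = RadPow∣-^ {2} 4 (subst (λ x → RadPow∣ 2 x M) z₁z₃≡
                (RadPow∣-* {2} (term-RadPow∣ (# 1)) (term-RadPow∣ (# 3))))

  gcd∣81 : gcd A B ∣ 81
  gcd∣81 = coprime-divisor (coprime-∣ˡ (coprime-^ 4 8 z₁z₃⊥e) g∣C) g∣e⁸81
    where
    adjacent : ∀ i → Coprime (z i) (z (i + 1))
    adjacent = coprime-adjacent-terms coprime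
    g∣A : gcd A B ∣ A
    g∣A = gcd[m,n]∣m A B
    g∣C : gcd A B ∣ C
    g∣C = subst (gcd A B ∣_) A+B≡C (∣m∣n⇒∣m+n g∣A (gcd[m,n]∣n A B))
    z₁z₃⊥z₂² : Coprime (y + 3 * s) (y + 4 * s)
    z₁z₃⊥z₂² = subst₂ Coprime z₁z₃≡ z₂²≡
      (coprime-^ʳ 2 (Coprime.sym (coprime-*ʳ (Coprime.sym (adjacent 1)) (adjacent 2))))
    z₁z₃⊥e : Coprime (y + 3 * s) e
    z₁z₃⊥e = subst (λ x → Coprime x e) z₁z₃≡
      (Coprime.sym (coprime-*ʳ (Coprime.sym (coprime-term coprime 1)) (Coprime.sym (coprime-term coprime 3))))
    g∣y : gcd A B ∣ y
    g∣y = coprime-divisor (coprime-∣ˡ (coprime-^ 4 3 z₁z₃⊥z₂²) g∣C)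
                          (subst (gcd A B ∣_) (*-comm y ((y + 4 * s) ^ 3)) g∣A)
    g∣e⁸81 : gcd A B ∣ e ^ 8 * 81
    g∣e⁸81 = subst (gcd A B ∣_) (solve 1 (λ e → (con 3 :* e :^ 2) :^ 4 := e :^ 8 :* con 81) refl e)
                   (∣-+-^⇒∣-^ (3 * s) 4 g∣y g∣C)

  abcTriple : AbcTriple 8 13 81 (5 ^ 5 * 451 ^ 2) n e h
  abcTriple = record
    { A = A ; B = B ; M = M
    ; A≥1   = *-mono-≤ y≥1 (^-monoˡ-≤ 3 (≤-trans y≥1 (m≤m+n y (4 * s))))
    ; B≥1   = *-mono-≤ (^-monoˡ-≤ 2 s≥1) R≥1
    ; M≥1   = M≥1 R≥1
    ; radSq = subst (λ x → RadPow∣ 2 (A * B * x) M) (sym A+B≡C) ABC-cover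
    ; gcd∣  = gcd∣81
    ; n^α≤  = subst (n ^ 8 ≤_) (sym A+B≡C) n⁸≤C
    ; M≤    = M≤cE*n¹³
    }

-- Lower bounds for θ_m

-- For d < N this encodes  log d / log N ≥ p / s − O(1 / t)  for every t.
PolyBound : (ℕ → ℕ → Set) → ℕ → ℕ → ℕ → Set
PolyBound P p s c = ∀ t → ∃[ K ] (∀ N d → 1 ≤ d → d < N → P N d → N ^ (p * t) ≤ K * d ^ (s * t + c))

ThetaAtLeast : (ℕ → ℕ → Set) → ℕ → ℕ → Set
ThetaAtLeast P a b = ∀ k → 1 ≤ k → ∃[ N₀ ] (∀ N d → N₀ ≤ N → 1 ≤ d → P N d → N ^ (a * k) ≤ d ^ (b * k) * N ^ b)

PolyBound-mono : ∀ {P Q : ℕ → ℕ → Set} {p s c} → (∀ {N d} → P N d → Q N d) → PolyBound Q p s c → PolyBound P p s c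
PolyBound-mono P⇒Q Q-bound t = map₂ (λ bound N d d≥1 d<N PNd → bound N d d≥1 d<N (P⇒Q PNd)) (Q-bound t)

AbcTriples⇒PolyBound : ∀ {m α β G c p s c′} κ → ABC → 1 ≤ κ → 1 ≤ G →
  (∀ {n e h} → ReducedSquarefullAP m n e h → AbcTriple α β G c n e h) →
  (∀ t → p * t + β * (t + κ + 1) ≤ α * (2 * (t + κ))) →
  (∀ t → p * t + (t + κ + 1) ≤ s * t + c′) →
  (∀ t → 2 * (t + κ + 1) ≤ s * t + c′) →
  PolyBound (SquarefullAP m) p s c′
AbcTriples⇒PolyBound {m} {α} {β} {G} {c} {p} {s} {c′} κ abc κ≥1 G≥1 triple abc-exponents u+v≤w 2v≤w t = X , bound
  where
  k K X : ℕ
  k = t + κ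
  K = proj₁ (abc⇒AbcBound abc k (≤-trans κ≥1 (m≤n+m κ t)))
  X = G ^ (2 * k) * K ^ 2 * c ^ (k + 1)
  abc-bound : AbcBound k K
  abc-bound = proj₂ (abc⇒AbcBound abc k (≤-trans κ≥1 (m≤n+m κ t)))
  bound : ∀ N d → 1 ≤ d → d < N → SquarefullAP m N d → N ^ (p * t) ≤ X * d ^ (s * t + c′)
  bound N d d≥1 d<N ap with reduce-squarefullAP d≥1 d<N ap
  ... | n , e , h , refl , refl , reduced = n^u≤⇒[nh]^u≤ {n} {X = X} {u = p * t} h≥1 e≥1 n^pt≤ (u+v≤w t) (2v≤w t)
    where
    open ReducedSquarefullAP reduced
    n^pt≤ : n ^ (p * t) ≤ X * (h * e ^ 2) ^ (k + 1)
    n^pt≤ = AbcTriple⇒bound {k} {K} {α} {β} {G} {c} {n} {e} {h} (p * t) abc-bound n≥1 G≥1 (triple reduced) (abc-exponents t)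

exponent-absorption : ∀ {a b p s} c k → s * a ≤ p * b → 1 ≤ b → 1 ≤ s →
                      let t = a * k * c + 1 in 1 + a * k * (s * t + c) ≤ p * t * (b * k) + b * (s * t + c)
exponent-absorption {a} {b} {p} {s} c k sa≤pb b≥1 s≥1 = begin
  1 + a * k * (s * t + c)         ≡⟨ solve 5 (λ a k s c one → one :+ a :* k :* (s :* (a :* k :* c :+ one) :+ c)
                                               := s :* a :* (k :* (a :* k :* c :+ one)) :+ (a :* k :* c :+ one)) refl a k s c 1 ⟩
  s * a * (k * t) + t             ≤⟨ +-mono-≤ (*-monoˡ-≤ (k * t) sa≤pb) t≤bT ⟩
  p * b * (k * t) + b * (s * t + c) ≡⟨ cong (_+ b * (s * t + c)) (solve 4 (λ p b k t → p :* b :* (k :* t) := p :* t :* (b :* k)) refl p b k t) ⟩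
  p * t * (b * k) + b * (s * t + c) ∎
  where
  open ≤-Reasoning
  t : ℕ
  t = a * k * c + 1
  t≤bT : t ≤ b * (s * t + c)
  t≤bT = begin
    t               ≤⟨ m≤n*m t s {{>-nonZero s≥1}} ⟩
    s * t           ≤⟨ m≤m+n (s * t) c ⟩
    s * t + c       ≤⟨ m≤n*m (s * t + c) b {{>-nonZero b≥1}} ⟩
    b * (s * t + c) ∎

-- Raise the claim to the power T = s t + c: the bound N^(p t) ≤ K d^T then costs only K^(b k), which
-- the spare factor N of exponent-absorption pays for once N > K^(b k).
large-N-bound : ∀ {a b p s c k K N d} .{{_ : NonZero K}} → s * a ≤ p * b → 1 ≤ b → 1 ≤ s → K ^ (b * k) < N →
                N ^ (p * (a * k * c + 1)) ≤ K * d ^ (s * (a * k * c + 1) + c) → N ^ (a * k) ≤ d ^ (b * k) * N ^ b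
large-N-bound {a} {b} {p} {s} {c} {k} {K} {N} {d} sa≤pb b≥1 s≥1 K^bk<N N^pt≤ =
  ^-cancelʳ-≤ T {{>-nonZero T≥1}} (*-cancelˡ-≤ (K ^ (b * k)) {{m^n≢0 K (b * k)}} (begin
    K ^ (b * k) * (N ^ (a * k)) ^ T               ≤⟨ *-monoˡ-≤ ((N ^ (a * k)) ^ T) (<⇒≤ K^bk<N) ⟩
    N * (N ^ (a * k)) ^ T                         ≡⟨ cong (N *_) (^-*-assoc N (a * k) T) ⟩
    N ^ (1 + a * k * T)                           ≤⟨ ^-monoʳ-≤ N (exponent-absorption {a} {b} {p} {s} c k sa≤pb b≥1 s≥1) ⟩
    N ^ (p * t * (b * k) + b * T)                 ≡⟨ trans (^-distribˡ-+-* N (p * t * (b * k)) (b * T))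
                                                       (sym (cong₂ _*_ (^-*-assoc N (p * t) (b * k)) (^-*-assoc N b T))) ⟩
    (N ^ (p * t)) ^ (b * k) * (N ^ b) ^ T         ≤⟨ *-monoˡ-≤ ((N ^ b) ^ T) (^-monoˡ-≤ (b * k) N^pt≤) ⟩
    (K * d ^ T) ^ (b * k) * (N ^ b) ^ T           ≡⟨ cong (_* (N ^ b) ^ T) (trans (^-distribʳ-* K (d ^ T) (b * k))
                                                       (cong (K ^ (b * k) *_) (^-*-comm d T (b * k)))) ⟩
    K ^ (b * k) * (d ^ (b * k)) ^ T * (N ^ b) ^ T ≡⟨ trans (*-assoc (K ^ (b * k)) _ _)
                                                       (cong (K ^ (b * k) *_) (sym (^-distribʳ-* (d ^ (b * k)) (N ^ b) T))) ⟩
    K ^ (b * k) * (d ^ (b * k) * N ^ b) ^ T       ∎))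
  where
  open ≤-Reasoning
  t T : ℕ
  t = a * k * c + 1
  T = s * t + c
  instance
    N≢0 : NonZero N
    N≢0 = >-nonZero (≤-trans (s≤s z≤n) K^bk<N)
  T≥1 : 1 ≤ T
  T≥1 = ≤-trans (≤-trans (m≤n+m 1 (a * k * c)) (m≤n*m t s {{>-nonZero s≥1}})) (m≤m+n (s * t) c)

PolyBound⇒ThetaAtLeast : ∀ {P p s c a b} → s * a ≤ p * b → a ≤ b → 1 ≤ b → 1 ≤ s → PolyBound P p s c → ThetaAtLeast P a b
PolyBound⇒ThetaAtLeast {P} {p} {s} {c} {a} {b} sa≤pb a≤b b≥1 s≥1 P-bound k _ = suc (K ^ (b * k)) , bound
  where
  t K : ℕ
  t = a * k * c + 1
  K = suc (proj₁ (P-bound t))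
  bound : ∀ N d → suc (K ^ (b * k)) ≤ N → 1 ≤ d → P N d → N ^ (a * k) ≤ d ^ (b * k) * N ^ b
  bound N d N₀≤N d≥1 PNd with N ≤? d
  ... | yes N≤d = begin
    N ^ (a * k)             ≤⟨ ^-monoʳ-≤ N (*-monoˡ-≤ k a≤b) ⟩
    N ^ (b * k)             ≤⟨ ^-monoˡ-≤ (b * k) N≤d ⟩
    d ^ (b * k)             ≤⟨ m≤m*n (d ^ (b * k)) (N ^ b) {{m^n≢0 N b}} ⟩
    d ^ (b * k) * N ^ b     ∎
    where
    open ≤-Reasoning
    instance
      N≢0 : NonZero N
      N≢0 = >-nonZero (≤-trans (s≤s z≤n) N₀≤N)
  ... | no  N≰d = large-N-bound {a} {b} {p} {s} {c} {k} {K} sa≤pb b≥1 s≥1 N₀≤N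
    (≤-trans (proj₂ (P-bound t) N d d≥1 (≰⇒> N≰d) PNd) (*-monoˡ-≤ (d ^ (s * t + c)) (n≤1+n (proj₁ (P-bound t)))))

polyBound₄ : ABC → PolyBound (SquarefullAP 4) 2 3 12
polyBound₄ abc = AbcTriples⇒PolyBound {p = 2} {3} {12} 3 abc (s≤s z≤n) (s≤s z≤n) FourTerms.abcTriple
  (λ t → m+n≡o⇒m≤o 0 (solve 1 (λ t → con 2 :* t :+ con 6 :* (t :+ con 3 :+ con 1) :+ con 0 := con 4 :* (con 2 :* (t :+ con 3))) refl t))
  (λ t → m+n≡o⇒m≤o 8 (solve 1 (λ t → con 2 :* t :+ (t :+ con 3 :+ con 1) :+ con 8 := con 3 :* t :+ con 12) refl t))
  (λ t → m+n≡o⇒m≤o (t + 4) (solve 1 (λ t → con 2 :* (t :+ con 3 :+ con 1) :+ (t :+ con 4) := con 3 :* t :+ con 12) refl t))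

polyBound₅ : ABC → PolyBound (SquarefullAP 5) 3 4 12
polyBound₅ abc = AbcTriples⇒PolyBound {p = 3} {4} {12} 5 abc (s≤s z≤n) (s≤s z≤n) FiveTerms.abcTriple
  (λ t → m+n≡o⇒m≤o 2 (solve 1 (λ t → con 3 :* t :+ con 13 :* (t :+ con 5 :+ con 1) :+ con 2 := con 8 :* (con 2 :* (t :+ con 5))) refl t))
  (λ t → m+n≡o⇒m≤o 6 (solve 1 (λ t → con 3 :* t :+ (t :+ con 5 :+ con 1) :+ con 6 := con 4 :* t :+ con 12) refl t))
  (λ t → m+n≡o⇒m≤o (2 * t) (solve 1 (λ t → con 2 :* (t :+ con 5 :+ con 1) :+ con 2 :* t := con 4 :* t :+ con 12) refl t))

thetaLower : ABC → ∀ r → ThetaLower (4 + r)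
thetaLower abc zero    = PolyBound⇒ThetaAtLeast {p = 2} {3} {12} (m≤m+n 18 2) (m≤m+n 6 4) (s≤s z≤n) (s≤s z≤n) (polyBound₄ abc)
thetaLower abc (suc r) = PolyBound⇒ThetaAtLeast {p = 3} {4} {12} sa≤pb a≤b (subst (1 ≤_) (sym b≡) (s≤s z≤n)) (s≤s z≤n)
                           (PolyBound-mono {p = 3} {4} {12} (squarefullAP-≤ (m≤m+n 5 r)) (polyBound₅ abc))
  where
  a≡ : 3 * (5 + r) ∸ 6 ≡ 9 + 3 * r
  a≡ = trans (cong (_∸ 6) (solve 1 (λ r → con 3 :* (con 5 :+ r) := con 6 :+ (con 9 :+ con 3 :* r)) refl r)) (m+n∸m≡n 6 (9 + 3 * r))
  b≡ : 4 * (5 + r) ∸ 6 ≡ 14 + 4 * r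
  b≡ = trans (cong (_∸ 6) (solve 1 (λ r → con 4 :* (con 5 :+ r) := con 6 :+ (con 14 :+ con 4 :* r)) refl r)) (m+n∸m≡n 6 (14 + 4 * r))
  sa≤pb : 4 * (3 * (5 + r) ∸ 6) ≤ 3 * (4 * (5 + r) ∸ 6)
  sa≤pb rewrite a≡ | b≡ = m+n≡o⇒m≤o 6 (solve 1 (λ r → con 4 :* (con 9 :+ con 3 :* r) :+ con 6 := con 3 :* (con 14 :+ con 4 :* r)) refl r)
  a≤b : 3 * (5 + r) ∸ 6 ≤ 4 * (5 + r) ∸ 6
  a≤b rewrite a≡ | b≡ = +-mono-≤ (m≤m+n 9 5) (*-monoˡ-≤ r (m≤m+n 3 1))

proposition3 : ABC → (m : ℕ) → 4 ≤ m → ThetaLower m × ThetaUpper m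
proposition3 abc 1 (s≤s ())
proposition3 abc 2 (s≤s (s≤s ()))
proposition3 abc 3 (s≤s (s≤s (s≤s ())))
proposition3 abc (suc (suc (suc (suc r)))) _ = thetaLower abc r , thetaUpper (2 + r)
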